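{- Let $r\in\{3,4,\dots,9\}$ and $\bar r=\lceil\frac{r-1}{3}\rceil$. Let $V_r=\{v_r(k):k\in[1,r]\}$ and $W_r=\{w_r(k):k\in[1,r]\}$ be disjoint sets of $r$ colours each, with indices read modulo $r$ (i.e. $u_r(m)=u_r(n)$ for $u\in\{v,w\}$ whenever $m\equiv n\pmod r$). Let $N_r$ be the $6\times r$ matrix with entries $(N_r)_{i,j}=v_r(i+j-1)$ for $i\in[1,3]$, $j\in[1,r]$, and $(N_r)_{i,j}=w_r((i-4)\bar r+j)$ for $i\in[4,6]$, $j\in[1,r]$. Then $N_r\in\mathcal M(6,r,V_r\cup W_r)$.
   Context: For integers $m\le n$, $[m,n]=\{z\in\mathbb Z:m\le z\le n\}$. For positive integers $p,q$ and a finite set $C$, $\mathcal M(p,q,C)$ is the set of $p\times q$ matrices $M$ with entries from $C$ such that every line (row or column) of $M$ has pairwise distinct entries, and for every pair of distinct colours $\alpha,\beta\in C$ there is a line of $M$ containing both $\alpha$ and $\beta$. -}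

module Defs where

open import Data.Nat using (ℕ; zero; suc; _+_; _*_; _∸_; NonZero)
open import Data.Nat.DivMod using (_/_; _mod_)
open import Data.Fin using (Fin; toℕ)
open import Data.Sum using (_⊎_; inj₁; inj₂)
open import Data.Product using (∃; _×_)
open import Relation.Binary.PropositionalEquality using (_≡_; _≢_)
open import Function.Definitions using (Injective)

⌈_/_⌉ : (m n : ℕ) .{{_ : NonZero n}} → ℕ
⌈ m / n ⌉ = (m + n ∸ 1) / n

rbar : ℕ → ℕ
rbar r = ⌈ (r ∸ 1) / 3 ⌉

Matrix : ℕ → ℕ → Set → Set
Matrix p q C = Fin p → Fin q → C

InRow : ∀ {p q} {C : Set} → Matrix p q C → Fin p → C → Set
InRow M i α = ∃ λ j → M i j ≡ α

InCol : ∀ {p q} {C : Set} → Matrix p q C → Fin q → C → Set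
InCol M j α = ∃ λ i → M i j ≡ α

record In𝓜 (p q : ℕ) (C : Set) (M : Matrix p q C) : Set where
  field
    rows-distinct : ∀ i → Injective _≡_ _≡_ (λ j → M i j)
    cols-distinct : ∀ j → Injective _≡_ _≡_ (λ i → M i j)
    pairs-covered : ∀ (α β : C) → α ≢ β →
      (∃ λ i → InRow M i α × InRow M i β) ⊎ (∃ λ j → InCol M j α × InCol M j β)

-- Colour set V_r ∪ W_r, as a disjoint union Fin r ⊎ Fin r.
-- v_r(k) is inj₁ (k mod r), w_r(k) is inj₂ (k mod r): indices read modulo r,
-- and {v_r(k) : k ∈ [1,r]} is all of inj₁ (Fin r), likewise for W_r.
Colour : ℕ → Set
Colour r = Fin r ⊎ Fin r

v : (r : ℕ) .{{_ : NonZero r}} → ℕ → Colour r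
v r k = inj₁ (k mod r)

w : (r : ℕ) .{{_ : NonZero r}} → ℕ → Colour r
w r k = inj₂ (k mod r)

-- N_r, 6×r. With 0-based indices i' = i-1, j' = j-1:
--   rows i ∈ [1,3]: v_r(i+j-1)            = v r (i' + j' + 1)
--   rows i ∈ [4,6]: w_r((i-4) r̄ + j)      = w r ((i' - 3) * r̄ + j' + 1)
Nentry : (r : ℕ) .{{_ : NonZero r}} → ℕ → ℕ → Colour r
Nentry r 0 j = v r (0 + j + 1)
Nentry r 1 j = v r (1 + j + 1)
Nentry r 2 j = v r (2 + j + 1)
Nentry r i j = w r ((i ∸ 3) * rbar r + j + 1)

N : (r : ℕ) .{{_ : NonZero r}} → Matrix 6 r (Colour r)
N r i j = Nentry r (toℕ i) (toℕ j)

-- For a fixed r, membership in 𝓜 quantifies only over finitely many lines, positions and colour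
-- pairs, so it is decidable; for each r ∈ [3,9] the decision procedure evaluates to `yes`.
module Submission where

open import Defs
open import Data.Nat using (ℕ; suc; _≤_; NonZero; s≤s)
open import Data.Fin using (Fin)
open import Data.Fin.Properties using (all?; any?) renaming (_≟_ to _≟ᶠ_)
open import Data.Sum using (_⊎_; inj₁; inj₂)
open import Data.Sum.Properties using (≡-dec)
open import Data.Product using (_,_)
open import Level using (0ℓ)
open import Relation.Nullary using (Dec; yes; no; ¬?)
open import Relation.Nullary.Decidable using (map′; _→-dec_; _×-dec_; _⊎-dec_; toWitness)
open import Relation.Unary using (Pred; Decidable)
open import Relation.Binary.Definitions using (DecidableEquality)
open import Relation.Binary.PropositionalEquality using (_≡_)
open import Function using (_∘_)
open import Function.Definitions using (Injective)

all-⊎? : {A B : Set} {P : Pred (A ⊎ B) 0ℓ} →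
         Dec (∀ a → P (inj₁ a)) → Dec (∀ b → P (inj₂ b)) → Dec (∀ c → P c)
all-⊎? (yes p₁) (yes p₂) = yes λ { (inj₁ a) → p₁ a ; (inj₂ b) → p₂ b }
all-⊎? (no ¬p₁) _        = no λ p → ¬p₁ (λ a → p (inj₁ a))
all-⊎? _        (no ¬p₂) = no λ p → ¬p₂ (λ b → p (inj₂ b))

module _ {C : Set} (_≟_ : DecidableEquality C) where

  injective? : ∀ {n} (f : Fin n → C) → Dec (Injective _≡_ _≡_ f)
  injective? f = map′ (λ inj {x} {y} → inj x y) (λ inj x y → inj)
    (all? λ x → all? λ y → (f x ≟ f y) →-dec (x ≟ᶠ y))

  inRow? : ∀ {p q} (M : Matrix p q C) i α → Dec (InRow M i α)
  inRow? M i α = any? λ j → M i j ≟ α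

  inCol? : ∀ {p q} (M : Matrix p q C) j α → Dec (InCol M j α)
  inCol? M j α = any? λ i → M i j ≟ α

  in𝓜? : (∀? : {P : Pred C 0ℓ} → Decidable P → Dec (∀ c → P c)) →
         ∀ {p q} (M : Matrix p q C) → Dec (In𝓜 p q C M)
  in𝓜? ∀? M = map′
    (λ (rd , cd , pc) → record { rows-distinct = rd ; cols-distinct = cd ; pairs-covered = pc })
    (λ m → In𝓜.rows-distinct m , In𝓜.cols-distinct m , In𝓜.pairs-covered m)
    (all? (λ i → injective? (M i)) ×-dec
     all? (λ j → injective? (λ i → M i j)) ×-dec
     ∀? λ α → ∀? λ β → ¬? (α ≟ β) →-dec
       ((any? λ i → inRow? M i α ×-dec inRow? M i β) ⊎-dec
        (any? λ j → inCol? M j α ×-dec inCol? M j β)))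

N-in𝓜? : (r : ℕ) .{{_ : NonZero r}} → Dec (In𝓜 6 r (Colour r) (N r))
N-in𝓜? r = in𝓜? (≡-dec _≟ᶠ_ _≟ᶠ_) (λ P? → all-⊎? (all? (P? ∘ inj₁)) (all? (P? ∘ inj₂))) (N r)

lemma5 : (r : ℕ) .{{_ : NonZero r}} → 3 ≤ r → r ≤ 9 → In𝓜 6 r (Colour r) (N r)
lemma5 3 _ _ = toWitness {a? = N-in𝓜? 3} _
lemma5 4 _ _ = toWitness {a? = N-in𝓜? 4} _
lemma5 5 _ _ = toWitness {a? = N-in𝓜? 5} _
lemma5 6 _ _ = toWitness {a? = N-in𝓜? 6} _
lemma5 7 _ _ = toWitness {a? = N-in𝓜? 7} _
lemma5 8 _ _ = toWitness {a? = N-in𝓜? 8} _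
lemma5 9 _ _ = toWitness {a? = N-in𝓜? 9} _
lemma5 (suc (suc (suc (suc (suc (suc (suc (suc (suc (suc _)))))))))) _
  (s≤s (s≤s (s≤s (s≤s (s≤s (s≤s (s≤s (s≤s (s≤s ())))))))))
lemma5 1 (s≤s ()) _
lemma5 2 (s≤s (s≤s ())) _
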